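{- Let $p$ be a prime and $N$ a positive integer, and let $J=\{0,1\}^N\subset\mathbb{F}_p^N$. Let $D_{\mathbb{F}_p}(J,N)$ denote the maximum cardinality of a set $H\subset\mathbb{F}_p^N$ such that no two distinct elements $\vec{x},\vec{y}\in H$ satisfy $\vec{x}-\vec{y}\in J$. Then $$D_{\mathbb{F}_p}(J,N)\le\left(1-\frac{1}{2}\left(1-\frac{1}{p-1}\right)^p\right)(p-1)^N.$$
   Context: $\mathbb{F}_p$ is the finite field with $p$ elements, and $\{0,1\}^N$ is viewed as a subset of $\mathbb{F}_p^N$ (vectors all of whose coordinates are $0$ or $1$). -}

module Defs where

open import Data.Nat as ℕ using (ℕ; zero; suc; _∸_; NonZero; _%_)
open import Data.Nat.DivMod using (_mod_)
open import Data.Nat.Primality using (Prime; prime⇒nonZero; prime⇒nonTrivial)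
open import Data.Fin as Fin using (Fin; toℕ)
open import Data.Vec using (Vec; zipWith)
open import Data.Vec.Relation.Unary.All using (All)
open import Data.Integer using (+_)
open import Data.Rational as ℚ using (ℚ; _/_; 1ℚ; _*_; _-_)

prime⇒pred-nonZero : ∀ {p} → Prime p → NonZero (p ∸ 1)
prime⇒pred-nonZero {p} pp = go p (prime⇒nonTrivial pp)
  where
  go : ∀ n → ℕ.NonTrivial n → NonZero (n ∸ 1)
  go (suc (suc k)) _ = _

-- 𝔽_p is modelled as Fin p (residues 0,…,p-1); 𝔽_p^N as Vec (Fin p) N.
Fp^ : ℕ → ℕ → Set
Fp^ p N = Vec (Fin p) N

subFp : ∀ {p} → Prime p → Fin p → Fin p → Fin p
subFp {p} pp a b = _mod_ (toℕ a ℕ.+ (p ∸ toℕ b)) p {{prime⇒nonZero pp}}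

subVec : ∀ {p N} → Prime p → Fp^ p N → Fp^ p N → Fp^ p N
subVec pp = zipWith (subFp pp)

InJ : ∀ {p N} → Fp^ p N → Set
InJ = All (λ c → toℕ c ℕ.≤ 1)

open import Data.List using (List)
open import Data.List.Membership.Propositional using (_∈_)
open import Relation.Binary.PropositionalEquality using (_≢_)
open import Relation.Nullary using (¬_)

J-DiffFree : ∀ {p N} → Prime p → List (Fp^ p N) → Set
J-DiffFree pp H = ∀ {x y} → x ∈ H → y ∈ H → x ≢ y → ¬ InJ (subVec pp x y)

_^ℚ_ : ℚ → ℕ → ℚ
q ^ℚ zero = 1ℚ
q ^ℚ suc n = q * (q ^ℚ n)

bound : ∀ {p} → Prime p → ℕ → ℚ
bound {p} pp N =
  (1ℚ - (+ 1 / 2) * ((1ℚ - _/_ (+ 1) (p ∸ 1) {{prime⇒pred-nonZero pp}}) ^ℚ p))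
    * ((+ (p ∸ 1) / 1) ^ℚ N)

-- Write f(x, y) = [y = x] − [y = x + 1] on 𝔽_p. This circulant matrix I − P has zero row sums,
-- so it factors through ℤ^(p−1), and its tensor power F(x, y) = ∏ᵢ f(xᵢ, yᵢ) on 𝔽_p^M factors
-- through ℤ^((p−1)^M). Now F(x, x) ≠ 0, and F(x, y) = 0 unless y − x ∈ J, so a list of points in
-- which no later point minus an earlier one lies in J yields a triangular system of vectors and
-- has length at most (p−1)^M. For H ⊂ 𝔽_p^(M+1), the fibres of the first coordinate over c and
-- c + 1, with that coordinate dropped, form such a list; summing over c counts every point twice,
-- so 2|H| ≤ p (p−1)^M. Finally p/2 · (p−1)^M ≤ (1 − ½ r^p) (p−1)^(M+1) for r = 1 − 1/(p−1),
-- since 0 ≤ r ≤ 1 gives r^p ≤ r.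

module Submission where

open import Data.Nat as ℕ using (ℕ; zero; suc)
import Data.Nat.Properties as ℕ
open import Data.Nat.Primality using (Prime; prime⇒nonTrivial; ¬prime[0]; ¬prime[1])
open import Data.List using (List; []; _∷_; length; map; filter; _++_)
open import Data.List.Relation.Unary.Unique.Propositional using (Unique)
open import Data.Empty using (⊥-elim)
open import Function using (_∘_)
open import Relation.Binary.PropositionalEquality
open import Defs

module _ where
  open import Data.Nat.Coprimality using (1-coprimeTo) renaming (sym to coprime-sym)
  open import Data.Integer as ℤ using (+_)
  import Data.Integer.Properties as ℤ
  open import Data.Rational using (ℚ; mkℚ; _/_; _≤_; 1ℚ; 0ℚ; _*_; _+_; _-_; -_; NonNegative; nonNegative; *≤*)
  open import Data.Rational.Properties
  open import Data.Rational.Solver using (module +-*-Solver)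

  ι : ℕ → ℚ
  ι n = + n / 1

  ι≡mkℚ : ∀ n → ι n ≡ mkℚ (+ n) 0 (coprime-sym (1-coprimeTo n))
  ι≡mkℚ n = normalize-coprime (coprime-sym (1-coprimeTo n))

  ι-homo-+ : ∀ a b → ι (a ℕ.+ b) ≡ ι a + ι b
  ι-homo-+ a b rewrite ι≡mkℚ a | ι≡mkℚ b =
    /-cong {+ (a ℕ.+ b)} (sym (cong₂ ℤ._+_ (ℤ.*-identityʳ (+ a)) (ℤ.*-identityʳ (+ b)))) refl

  ι-homo-* : ∀ a b → ι (a ℕ.* b) ≡ ι a * ι b
  ι-homo-* a b rewrite ι≡mkℚ a | ι≡mkℚ b = /-cong {+ (a ℕ.* b)} (ℤ.pos-* a b) refl

  ι-homo-^ : ∀ a k → ι (a ℕ.^ k) ≡ ι a ^ℚ k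
  ι-homo-^ a zero = refl
  ι-homo-^ a (suc k) = trans (ι-homo-* a (a ℕ.^ k)) (cong (ι a *_) (ι-homo-^ a k))

  ι-mono-≤ : ∀ {a b} → a ℕ.≤ b → ι a ≤ ι b
  ι-mono-≤ {a} {b} a≤b rewrite ι≡mkℚ a | ι≡mkℚ b =
    *≤* (subst₂ ℤ._≤_ (sym (ℤ.*-identityʳ (+ a))) (sym (ℤ.*-identityʳ (+ b))) (ℤ.+≤+ a≤b))

  ι-nonNeg : ∀ n → NonNegative (ι n)
  ι-nonNeg n = normalize-nonNeg n 1

  module _ {r : ℚ} (0≤r : 0ℚ ≤ r) (r≤1 : r ≤ 1ℚ) where

    private
      r*-≤-r : ∀ {x} → x ≤ 1ℚ → r * x ≤ r
      r*-≤-r x≤1 = subst (r * _ ≤_) (*-identityʳ r) (*-monoˡ-≤-nonNeg r {{nonNegative 0≤r}} x≤1)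

    ^ℚ-≤-1 : ∀ k → r ^ℚ k ≤ 1ℚ
    ^ℚ-≤-1 zero = ≤-refl
    ^ℚ-≤-1 (suc k) = ≤-trans (r*-≤-r (^ℚ-≤-1 k)) r≤1

    ^ℚ-suc-≤ : ∀ k → r ^ℚ suc k ≤ r
    ^ℚ-suc-≤ k = r*-≤-r (^ℚ-≤-1 k)

  ½ : ℚ
  ½ = + 1 / 2

  ½*2≡1 : ½ * ι 2 ≡ 1ℚ
  ½*2≡1 = refl

  module _ (q′ : ℕ) where

    private
      q : ℕ
      q = suc q′
      Q u r : ℚ
      Q = ι q
      u = + 1 / q
      r = 1ℚ - u

    u≡mkℚ : u ≡ mkℚ (+ 1) q′ (1-coprimeTo q)
    u≡mkℚ = normalize-coprime (1-coprimeTo q)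

    u*Q≡1 : u * Q ≡ 1ℚ
    u*Q≡1 rewrite u≡mkℚ | ι≡mkℚ q = *-inverseˡ (mkℚ (+ q) 0 (coprime-sym (1-coprimeTo q)))

    0≤u : 0ℚ ≤ u
    0≤u = nonNegative⁻¹ u {{normalize-nonNeg 1 q}}

    u≤1 : u ≤ 1ℚ
    u≤1 rewrite u≡mkℚ = *≤* (ℤ.+≤+ (ℕ.s≤s ℕ.z≤n))

    0≤r : 0ℚ ≤ r
    0≤r = subst (_≤ r) (+-inverseʳ u) (+-monoˡ-≤ (- u) u≤1)

    r≤1 : r ≤ 1ℚ
    r≤1 = subst (r ≤_) (+-identityʳ 1ℚ) (+-monoʳ-≤ 1ℚ (neg-antimono-≤ 0≤u))

    [1-½r]*Q≡½[1+Q] : (1ℚ - ½ * r) * Q ≡ ½ * (1ℚ + Q)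
    [1-½r]*Q≡½[1+Q] = begin
      (1ℚ - ½ * (1ℚ - u)) * Q      ≡⟨ expand ½ u Q ⟩
      (1ℚ - ½) * Q + ½ * (u * Q)   ≡⟨ cong (λ x → (1ℚ - ½) * Q + ½ * x) u*Q≡1 ⟩
      ½ * Q + ½ * 1ℚ               ≡⟨ collect ½ Q ⟩
      ½ * (1ℚ + Q)                 ∎
      where
      open ≡-Reasoning
      open +-*-Solver
      expand : ∀ h u Q → (1ℚ - h * (1ℚ - u)) * Q ≡ (1ℚ - h) * Q + h * (u * Q)
      expand = solve 3 (λ h u Q → (con 1ℚ :- h :* (con 1ℚ :- u)) :* Q := (con 1ℚ :- h) :* Q :+ h :* (u :* Q)) refl
      collect : ∀ h Q → h * Q + h * 1ℚ ≡ h * (1ℚ + Q)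
      collect = solve 2 (λ h Q → h :* Q :+ h :* con 1ℚ := h :* (con 1ℚ :+ Q)) refl

    halving-bound : ∀ M n → 2 ℕ.* n ℕ.≤ suc q ℕ.* q ℕ.^ M →
      ι n ≤ (1ℚ - ½ * r ^ℚ suc q) * Q ^ℚ suc M
    halving-bound M n 2n≤[1+q]qᴹ = begin
      ι n                              ≡⟨ trans (cong (_* ι n) ½*2≡1) (*-identityˡ (ι n)) ⟨
      ½ * ι 2 * ι n                    ≡⟨ *-assoc ½ (ι 2) (ι n) ⟩
      ½ * (ι 2 * ι n)                  ≡⟨ cong (½ *_) (ι-homo-* 2 n) ⟨
      ½ * ι (2 ℕ.* n)                  ≤⟨ *-monoˡ-≤-nonNeg ½ (ι-mono-≤ 2n≤[1+q]qᴹ) ⟩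
      ½ * ι (suc q ℕ.* q ℕ.^ M)        ≡⟨ cong (½ *_) (trans (ι-homo-* (suc q) (q ℕ.^ M))
                                                             (cong₂ _*_ (ι-homo-+ 1 q) (ι-homo-^ q M))) ⟩
      ½ * ((1ℚ + Q) * Q ^ℚ M)          ≡⟨ *-assoc ½ (1ℚ + Q) (Q ^ℚ M) ⟨
      ½ * (1ℚ + Q) * Q ^ℚ M            ≡⟨ cong (_* Q ^ℚ M) [1-½r]*Q≡½[1+Q] ⟨
      (1ℚ - ½ * r) * Q * Q ^ℚ M        ≡⟨ *-assoc (1ℚ - ½ * r) Q (Q ^ℚ M) ⟩
      (1ℚ - ½ * r) * Q ^ℚ suc M        ≤⟨ *-monoʳ-≤-nonNeg (Q ^ℚ suc M) {{Qᴹ⁺¹-nonNeg}} 1-½r≤1-½rᵖ ⟩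
      (1ℚ - ½ * r ^ℚ suc q) * Q ^ℚ suc M ∎
      where
      open ≤-Reasoning
      Qᴹ⁺¹-nonNeg : NonNegative (Q ^ℚ suc M)
      Qᴹ⁺¹-nonNeg = subst NonNegative (ι-homo-^ q (suc M)) (ι-nonNeg (q ℕ.^ suc M))
      1-½r≤1-½rᵖ : 1ℚ - ½ * r ≤ 1ℚ - ½ * r ^ℚ suc q
      1-½r≤1-½rᵖ = +-monoʳ-≤ 1ℚ (neg-antimono-≤ (*-monoˡ-≤-nonNeg ½ (^ℚ-suc-≤ 0≤r r≤1 q)))

open import Data.Nat using (z≤n; s≤s; _≤_; _∸_)
open import Data.Nat.DivMod using (_%_; m<n⇒m%n≡m; [m+n]%n≡m%n; n%n≡0)
open import Data.Integer as ℤ using (ℤ; 0ℤ; 1ℤ; _+_; _*_; _-_; -_)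
open import Data.Integer.Properties
  using (*-zeroʳ; *-identityˡ; *-identityʳ; *-comm; +-identityˡ; +-identityʳ; i*j≡0⇒i≡0∨j≡0; +-*-ring; +-*-semiring)
open import Data.Integer.Tactic.RingSolver using (solve-∀)
open import Algebra.Properties.Ring +-*-ring using (-1*x≈-x; +-inverseʳ-unique)
open import Algebra.Properties.Semiring.Sum +-*-semiring
  using (sum; sum-cong-≗; sum-replicate-zero; sum-init-last; ∑-distrib-+; *-distribʳ-sum)
import Algebra.Properties.CommutativeMonoid.Sum as CommutativeMonoidSum
open import Data.Fin using (Fin; zero; suc; inject₁; fromℕ; toℕ)
open import Data.Fin.Properties using (_≟_; toℕ-fromℕ<; toℕ-fromℕ; toℕ-inject₁; toℕ<n)
open import Data.Fin.Relation.Unary.Top using (view; ‵fromℕ; ‵inject₁; view-fromℕ; view-inject₁)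
open import Data.Bool using (true; false; if_then_else_)
open import Data.Vec as Vec using (Vec; []; _∷_; lookup; removeAt; tabulate; head; tail)
  renaming (_++_ to _++ᵥ_)
import Data.Vec.Relation.Unary.All as VecAll
open import Data.List.Properties using (length-map; length-++)
open import Data.List.Membership.Propositional using (_∈_)
open import Data.List.Membership.Propositional.Properties using (∈-filter⁻)
open import Data.List.Relation.Unary.Any using (here; there)
open import Data.List.Relation.Unary.All as All using (All; _∷_)
import Data.List.Relation.Unary.All.Properties as All
open import Data.List.Relation.Unary.AllPairs as AllPairs using (AllPairs; []; _∷_)
import Data.List.Relation.Unary.AllPairs.Properties as AllPairs
import Data.List.Relation.Unary.Unique.Propositional.Properties as Unique
open import Data.Product using (∃-syntax; _×_; _,_; proj₂)
open import Data.Sum using (inj₁; inj₂)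
open import Data.Unit using (⊤; tt)
open import Relation.Unary using (Decidable)
open import Relation.Nullary using (yes; no; ¬_; does; Dec)
open import Relation.Nullary.Decidable using (dec-true; dec-false)
open import Data.Rational as ℚ using (_/_)

dot : ∀ {n} → Vec ℤ n → Vec ℤ n → ℤ
dot [] [] = 0ℤ
dot (x ∷ u) (y ∷ v) = x * y + dot u v

_⊥_ : ∀ {n} → Vec ℤ n → Vec ℤ n → Set
a ⊥ b = dot a b ≡ 0ℤ

lincomb : ∀ {n} → ℤ → Vec ℤ n → ℤ → Vec ℤ n → Vec ℤ n
lincomb α [] β [] = []
lincomb α (x ∷ u) β (y ∷ v) = (α * x - β * y) ∷ lincomb α u β v

dot-lincomb : ∀ {n} α (u : Vec ℤ n) β v w → dot (lincomb α u β v) w ≡ α * dot u w - β * dot v w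
dot-lincomb α [] β [] [] = sym (cong₂ _-_ (*-zeroʳ α) (*-zeroʳ β))
dot-lincomb α (x ∷ u) β (y ∷ v) (z ∷ w) =
  trans (cong ((α * x - β * y) * z +_) (dot-lincomb α u β v w)) (distribute α β x y z (dot u w) (dot v w))
  where
  distribute : ∀ α β x y z r s → (α * x - β * y) * z + (α * r - β * s) ≡ α * (x * z + r) - β * (y * z + s)
  distribute = solve-∀

dot-removeAt : ∀ {n} (u v : Vec ℤ (suc n)) k →
  dot u v ≡ lookup u k * lookup v k + dot (removeAt u k) (removeAt v k)
dot-removeAt (x ∷ u) (y ∷ v) zero = refl
dot-removeAt (x ∷ u@(_ ∷ _)) (y ∷ v@(_ ∷ _)) (suc k) =
  trans (cong (x * y +_) (dot-removeAt u v k)) (swap (x * y) (lookup u k * lookup v k) _)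
  where
  swap : ∀ a b c → a + (b + c) ≡ b + (a + c)
  swap = solve-∀

nonzero-entry : ∀ {n} (a b : Vec ℤ n) → dot a b ≢ 0ℤ → ∃[ k ] lookup a k ≢ 0ℤ
nonzero-entry [] [] ab≢0 = ⊥-elim (ab≢0 refl)
nonzero-entry (x ∷ a) (y ∷ b) ab≢0 with x ℤ.≟ 0ℤ
... | no x≢0 = zero , x≢0
... | yes refl with nonzero-entry a b (ab≢0 ∘ cong (0ℤ +_))
...   | k , aₖ≢0 = suc k , aₖ≢0

Triangular : ∀ {d} → List (Vec ℤ d × Vec ℤ d) → Set
Triangular [] = ⊤
Triangular ((a , b) ∷ ps) = ¬ a ⊥ b × All ((a ⊥_) ∘ proj₂) ps × Triangular ps

eliminate : ∀ {d} (a : Vec ℤ (suc d)) (k : Fin (suc d)) → Vec ℤ (suc d) → Vec ℤ d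
eliminate a k u = lincomb (lookup a k) (removeAt u k) (lookup u k) (removeAt a k)

dot-eliminate : ∀ {d} a k (u w : Vec ℤ (suc d)) → a ⊥ w →
  dot (eliminate a k u) (removeAt w k) ≡ lookup a k * dot u w
dot-eliminate a k u w a⊥w = begin
  dot (lincomb aₖ (removeAt u k) uₖ (removeAt a k)) (removeAt w k)
    ≡⟨ dot-lincomb aₖ (removeAt u k) uₖ (removeAt a k) (removeAt w k) ⟩
  aₖ * dot (removeAt u k) (removeAt w k) - uₖ * dot (removeAt a k) (removeAt w k)
    ≡⟨ expand aₖ uₖ (lookup w k) _ _ ⟩
  aₖ * (uₖ * lookup w k + dot (removeAt u k) (removeAt w k))
    - uₖ * (aₖ * lookup w k + dot (removeAt a k) (removeAt w k))
    ≡⟨ cong₂ (λ s t → aₖ * s - uₖ * t) (sym (dot-removeAt u w k)) (trans (sym (dot-removeAt a w k)) a⊥w) ⟩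
  aₖ * dot u w - uₖ * 0ℤ
    ≡⟨ cancel (aₖ * dot u w) uₖ ⟩
  aₖ * dot u w ∎
  where
  open ≡-Reasoning
  aₖ uₖ : ℤ
  aₖ = lookup a k
  uₖ = lookup u k
  expand : ∀ a u w P Q → a * P - u * Q ≡ a * (u * w + P) - u * (a * w + Q)
  expand = solve-∀
  cancel : ∀ x u → x - u * 0ℤ ≡ x
  cancel = solve-∀

reduce : ∀ {d} (a : Vec ℤ (suc d)) (k : Fin (suc d)) → Vec ℤ (suc d) × Vec ℤ (suc d) → Vec ℤ d × Vec ℤ d
reduce a k (u , v) = eliminate a k u , removeAt v k

*-cancelˡ-≡0 : ∀ {a x} → a ≢ 0ℤ → a * x ≡ 0ℤ → x ≡ 0ℤ
*-cancelˡ-≡0 {a} a≢0 ax≡0 with i*j≡0⇒i≡0∨j≡0 a ax≡0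
... | inj₁ a≡0 = ⊥-elim (a≢0 a≡0)
... | inj₂ x≡0 = x≡0

reduce-triangular : ∀ {d} a k {ps : List (Vec ℤ (suc d) × Vec ℤ (suc d))} → lookup a k ≢ 0ℤ →
  All ((a ⊥_) ∘ proj₂) ps → Triangular ps → Triangular (map (reduce a k) ps)
reduce-triangular a k {[]} _ _ _ = tt
reduce-triangular a k {(u , v) ∷ ps} aₖ≢0 (a⊥v ∷ a⊥ps) (u⊥̸v , u⊥ps , tri) =
    (λ e → u⊥̸v (*-cancelˡ-≡0 aₖ≢0 (trans (sym (dot-eliminate a k u v a⊥v)) e)))
  , All.map⁺ (All.zipWith reduced-orthogonal (a⊥ps , u⊥ps))
  , reduce-triangular a k aₖ≢0 a⊥ps tri
  where
  reduced-orthogonal : ∀ {w} → a ⊥ w × u ⊥ w → eliminate a k u ⊥ removeAt w k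
  reduced-orthogonal {w} (a⊥w , u⊥w) =
    trans (dot-eliminate a k u w a⊥w) (trans (cong (lookup a k *_) u⊥w) (*-zeroʳ (lookup a k)))

triangular-length≤ : ∀ d (ps : List (Vec ℤ d × Vec ℤ d)) → Triangular ps → length ps ≤ d
triangular-length≤ d [] _ = z≤n
triangular-length≤ zero (([] , []) ∷ _) (a⊥̸b , _) = ⊥-elim (a⊥̸b refl)
triangular-length≤ (suc d) ((a , b) ∷ ps) (a⊥̸b , a⊥ps , tri) with nonzero-entry a b a⊥̸b
... | k , aₖ≢0 = s≤s (subst (_≤ d) (length-map (reduce a k) ps)
                        (triangular-length≤ d (map (reduce a k) ps) (reduce-triangular a k aₖ≢0 a⊥ps tri)))

record Factorisation {X Y : Set} (K : X → Y → ℤ) (d : ℕ) : Set where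
  field
    left  : X → Vec ℤ d
    right : Y → Vec ℤ d
    dot-left-right : ∀ x y → dot (left x) (right y) ≡ K x y

chain-length≤ : ∀ {X : Set} {K : X → X → ℤ} {d} → Factorisation K d → (∀ x → K x x ≢ 0ℤ) →
  ∀ {xs} → AllPairs (λ x y → K x y ≡ 0ℤ) xs → length xs ≤ d
chain-length≤ {X} {K} {d} F diag {xs} chain =
  subst (_≤ d) (length-map pair xs) (triangular-length≤ d (map pair xs) (triangular chain))
  where
  open Factorisation F
  pair : X → Vec ℤ d × Vec ℤ d
  pair x = left x , right x
  triangular : ∀ {xs} → AllPairs (λ x y → K x y ≡ 0ℤ) xs → Triangular (map pair xs)
  triangular [] = tt
  triangular {x ∷ _} (Kx≡0 ∷ chain) =
      diag x ∘ trans (sym (dot-left-right x x))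
    , All.map⁺ (All.map (trans (dot-left-right x _)) Kx≡0)
    , triangular chain

tensor : ∀ {m n} → Vec ℤ m → Vec ℤ n → Vec ℤ (m ℕ.* n)
tensor [] v = []
tensor (x ∷ u) v = Vec.map (x *_) v ++ᵥ tensor u v

dot-++ : ∀ {m n} (u v : Vec ℤ m) (u′ v′ : Vec ℤ n) → dot (u ++ᵥ u′) (v ++ᵥ v′) ≡ dot u v + dot u′ v′
dot-++ [] [] u′ v′ = sym (+-identityˡ (dot u′ v′))
dot-++ (x ∷ u) (y ∷ v) u′ v′ = trans (cong (x * y +_) (dot-++ u v u′ v′)) (assoc (x * y) _ _)
  where
  assoc : ∀ a b c → a + (b + c) ≡ (a + b) + c
  assoc = solve-∀

dot-scale : ∀ {n} x y (v w : Vec ℤ n) → dot (Vec.map (x *_) v) (Vec.map (y *_) w) ≡ x * y * dot v w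
dot-scale x y [] [] = sym (*-zeroʳ (x * y))
dot-scale x y (a ∷ v) (b ∷ w) = trans (cong (x * a * (y * b) +_) (dot-scale x y v w)) (factor x y a b _)
  where
  factor : ∀ x y a b r → x * a * (y * b) + x * y * r ≡ x * y * (a * b + r)
  factor = solve-∀

dot-tensor : ∀ {m n} (u v : Vec ℤ m) (u′ v′ : Vec ℤ n) → dot (tensor u u′) (tensor v v′) ≡ dot u v * dot u′ v′
dot-tensor [] [] u′ v′ = refl
dot-tensor (x ∷ u) (y ∷ v) u′ v′ = begin
  dot (Vec.map (x *_) u′ ++ᵥ tensor u u′) (Vec.map (y *_) v′ ++ᵥ tensor v v′)
    ≡⟨ dot-++ (Vec.map (x *_) u′) (Vec.map (y *_) v′) (tensor u u′) (tensor v v′) ⟩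
  dot (Vec.map (x *_) u′) (Vec.map (y *_) v′) + dot (tensor u u′) (tensor v v′)
    ≡⟨ cong₂ _+_ (dot-scale x y u′ v′) (dot-tensor u v u′ v′) ⟩
  x * y * dot u′ v′ + dot u v * dot u′ v′
    ≡⟨ distrib (x * y) (dot u v) (dot u′ v′) ⟩
  (x * y + dot u v) * dot u′ v′ ∎
  where
  open ≡-Reasoning
  distrib : ∀ a b c → a * c + b * c ≡ (a + b) * c
  distrib = solve-∀

kernelPower : ∀ {A B : Set} → (A → B → ℤ) → ∀ {M} → Vec A M → Vec B M → ℤ
kernelPower K [] [] = 1ℤ
kernelPower K (x ∷ xs) (y ∷ ys) = K x y * kernelPower K xs ys

kernelPower-factorisation : ∀ {A B : Set} {K : A → B → ℤ} {d} → Factorisation K d →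
  ∀ M → Factorisation (kernelPower K {M}) (d ℕ.^ M)
kernelPower-factorisation {A} {B} {K} {d} F M = record
  { left = leftᴹ ; right = rightᴹ ; dot-left-right = dot-leftᴹ-rightᴹ }
  where
  open Factorisation F
  leftᴹ : ∀ {M} → Vec A M → Vec ℤ (d ℕ.^ M)
  leftᴹ [] = 1ℤ ∷ []
  leftᴹ (x ∷ xs) = tensor (left x) (leftᴹ xs)
  rightᴹ : ∀ {M} → Vec B M → Vec ℤ (d ℕ.^ M)
  rightᴹ [] = 1ℤ ∷ []
  rightᴹ (y ∷ ys) = tensor (right y) (rightᴹ ys)
  dot-leftᴹ-rightᴹ : ∀ {M} xs ys → dot (leftᴹ {M} xs) (rightᴹ ys) ≡ kernelPower K xs ys
  dot-leftᴹ-rightᴹ [] [] = refl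
  dot-leftᴹ-rightᴹ (x ∷ xs) (y ∷ ys) =
    trans (dot-tensor (left x) (right y) (leftᴹ xs) (rightᴹ ys))
          (cong₂ _*_ (dot-left-right x y) (dot-leftᴹ-rightᴹ xs ys))

kernelPower-diagonal≢0 : ∀ {A : Set} {K : A → A → ℤ} → (∀ x → K x x ≢ 0ℤ) →
  ∀ {M} (xs : Vec A M) → kernelPower K xs xs ≢ 0ℤ
kernelPower-diagonal≢0 diag [] ()
kernelPower-diagonal≢0 diag (x ∷ xs) e with i*j≡0⇒i≡0∨j≡0 _ e
... | inj₁ Kxx≡0 = diag x Kxx≡0
... | inj₂ rest≡0 = kernelPower-diagonal≢0 diag xs rest≡0

δ : ∀ {n} → Fin n → Fin n → ℤ
δ i j = if does (i ≟ j) then 1ℤ else 0ℤ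

δ-refl : ∀ {n} (i : Fin n) → δ i i ≡ 1ℤ
δ-refl i = cong (λ b → if b then 1ℤ else 0ℤ) (dec-true (i ≟ i) refl)

δ-≢ : ∀ {n} {i j : Fin n} → i ≢ j → δ i j ≡ 0ℤ
δ-≢ {i = i} {j} i≢j = cong (λ b → if b then 1ℤ else 0ℤ) (dec-false (i ≟ j) i≢j)

sum-select : ∀ {n} (g : Fin n → ℤ) j → sum (λ k → g k * δ k j) ≡ g j
sum-select {suc n} g zero = begin
  g zero * 1ℤ + sum (λ k → g (suc k) * 0ℤ) ≡⟨ cong₂ _+_ (*-identityʳ (g zero)) (sum-cong-≗ (*-zeroʳ ∘ g ∘ suc)) ⟩
  g zero + sum {n} (λ _ → 0ℤ)               ≡⟨ cong (g zero +_) (sum-replicate-zero n) ⟩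
  g zero + 0ℤ                               ≡⟨ +-identityʳ (g zero) ⟩
  g zero                                    ∎
  where open ≡-Reasoning
sum-select {suc n} g (suc j) =
  trans (cong (_+ sum (λ k → g (suc k) * δ k j)) (*-zeroʳ (g zero)))
        (trans (+-identityˡ _) (sum-select (g ∘ suc) j))

dot-tabulate : ∀ {n} (g h : Fin n → ℤ) → dot (tabulate g) (tabulate h) ≡ sum (λ k → g k * h k)
dot-tabulate {zero} g h = refl
dot-tabulate {suc n} g h = cong (g zero * h zero +_) (dot-tabulate (g ∘ suc) (h ∘ suc))

-- The last column of K is minus the sum of the others, so it can be dropped.
zeroRowSum-factorisation : ∀ {X : Set} {q} (K : X → Fin (suc q) → ℤ) → (∀ x → sum (K x) ≡ 0ℤ) →
  Factorisation K q
zeroRowSum-factorisation {X} {q} K rowSum≡0 =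
  record { left = left ; right = right ; dot-left-right = dot-left-right }
  where
  left : X → Vec ℤ q
  left x = tabulate (K x ∘ inject₁)
  right : Fin (suc q) → Vec ℤ q
  right y with view y
  ... | ‵fromℕ = tabulate (λ _ → - 1ℤ)
  ... | ‵inject₁ j = tabulate (λ k → δ k j)
  dot-left-right : ∀ x y → dot (left x) (right y) ≡ K x y
  dot-left-right x y with view y
  ... | ‵fromℕ = begin
    dot (tabulate (K x ∘ inject₁)) (tabulate (λ _ → - 1ℤ)) ≡⟨ dot-tabulate (K x ∘ inject₁) _ ⟩
    sum (λ k → K x (inject₁ k) * - 1ℤ)                    ≡⟨ *-distribʳ-sum (- 1ℤ) (K x ∘ inject₁) ⟨
    sum (K x ∘ inject₁) * - 1ℤ                            ≡⟨ trans (*-comm _ (- 1ℤ)) (-1*x≈-x _) ⟩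
    - sum (K x ∘ inject₁)                                 ≡⟨ +-inverseʳ-unique _ _ lastColumn ⟨
    K x (fromℕ q)                                         ∎
    where
    open ≡-Reasoning
    lastColumn : sum (K x ∘ inject₁) + K x (fromℕ q) ≡ 0ℤ
    lastColumn = trans (sym (sum-init-last (K x))) (rowSum≡0 x)
  ... | ‵inject₁ j = trans (dot-tabulate (K x ∘ inject₁) _) (sum-select (K x ∘ inject₁) j)

sucMod : ∀ {n} → Fin (suc n) → Fin (suc n)
sucMod i with view i
... | ‵fromℕ = zero
... | ‵inject₁ j = suc j

sucMod-fromℕ : ∀ n → sucMod (fromℕ n) ≡ zero
sucMod-fromℕ n rewrite view-fromℕ n = refl

sucMod-inject₁ : ∀ {n} (j : Fin n) → sucMod (inject₁ j) ≡ suc j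
sucMod-inject₁ j rewrite view-inject₁ j = refl

cyclicDifference : ∀ {n} → Fin (suc n) → Fin (suc n) → ℤ
cyclicDifference x y = δ y x - δ y (sucMod x)

cyclicDifference-rowSum : ∀ {n} (x : Fin (suc n)) → sum (cyclicDifference x) ≡ 0ℤ
cyclicDifference-rowSum x = begin
  sum (λ y → δ y x - δ y (sucMod x))
    ≡⟨ ∑-distrib-+ (λ y → δ y x) (λ y → - δ y (sucMod x)) ⟩
  sum (λ y → δ y x) + sum (λ y → - δ y (sucMod x))
    ≡⟨ cong₂ _+_ (sum-cong-≗ (λ y → sym (*-identityˡ (δ y x))))
                 (sum-cong-≗ (λ y → sym (-1*x≈-x (δ y (sucMod x))))) ⟩
  sum (λ y → 1ℤ * δ y x) + sum (λ y → - 1ℤ * δ y (sucMod x))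
    ≡⟨ cong₂ _+_ (sum-select (λ _ → 1ℤ) x) (sum-select (λ _ → - 1ℤ) (sucMod x)) ⟩
  1ℤ + - 1ℤ ∎
  where open ≡-Reasoning

module ℕ∑ = CommutativeMonoidSum ℕ.+-0-commutativeMonoid

ℕ∑-∘sucMod : ∀ {n} (g : Fin (suc n) → ℕ) → ℕ∑.sum (g ∘ sucMod) ≡ ℕ∑.sum g
ℕ∑-∘sucMod {n} g = begin
  ℕ∑.sum (g ∘ sucMod)
    ≡⟨ ℕ∑.sum-init-last (g ∘ sucMod) ⟩
  ℕ∑.sum (g ∘ sucMod ∘ inject₁) ℕ.+ g (sucMod (fromℕ n))
    ≡⟨ cong₂ ℕ._+_ (ℕ∑.sum-cong-≗ (cong g ∘ sucMod-inject₁)) (cong g (sucMod-fromℕ n)) ⟩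
  ℕ∑.sum (g ∘ suc) ℕ.+ g zero
    ≡⟨ ℕ.+-comm _ (g zero) ⟩
  ℕ∑.sum g ∎
  where open ≡-Reasoning

ℕ∑-≤-* : ∀ {n} (g : Fin n → ℕ) {k} → (∀ i → g i ≤ k) → ℕ∑.sum g ≤ n ℕ.* k
ℕ∑-≤-* {zero} g _ = z≤n
ℕ∑-≤-* {suc n} g g≤k = ℕ.+-mono-≤ (g≤k zero) (ℕ∑-≤-* (g ∘ suc) (g≤k ∘ suc))

ℕ∑-indicator : ∀ {n} (i : Fin n) → ℕ∑.sum (λ c → if does (i ≟ c) then 1 else 0) ≡ 1
ℕ∑-indicator {suc n} zero = cong suc (ℕ∑.sum-replicate-zero n)
ℕ∑-indicator {suc n} (suc i) = ℕ∑-indicator i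

length-filter-∷ : ∀ {A : Set} {P : A → Set} (P? : Decidable P) x xs →
  length (filter P? (x ∷ xs)) ≡ (if does (P? x) then 1 else 0) ℕ.+ length (filter P? xs)
length-filter-∷ P? x xs with does (P? x)
... | true = refl
... | false = refl

ℕ∑-length-filter : ∀ {A : Set} {n} (f : A → Fin n) (xs : List A) →
  ℕ∑.sum (λ c → length (filter (λ x → f x ≟ c) xs)) ≡ length xs
ℕ∑-length-filter {n = n} f [] = ℕ∑.sum-replicate-zero n
ℕ∑-length-filter {n = n} f (x ∷ xs) = begin
  ℕ∑.sum (λ c → length (filter (f≟ c) (x ∷ xs))) ≡⟨ ℕ∑.sum-cong-≗ (λ c → length-filter-∷ (f≟ c) x xs) ⟩
  ℕ∑.sum (λ c → hit c ℕ.+ rest c)                ≡⟨ ℕ∑.∑-distrib-+ hit rest ⟩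
  ℕ∑.sum hit ℕ.+ ℕ∑.sum rest                     ≡⟨ cong₂ ℕ._+_ (ℕ∑-indicator (f x)) (ℕ∑-length-filter f xs) ⟩
  suc (length xs)                                ∎
  where
  open ≡-Reasoning
  f≟ : ∀ c y → Dec (f y ≡ c)
  f≟ c y = f y ≟ c
  hit rest : Fin n → ℕ
  hit c = if does (f x ≟ c) then 1 else 0
  rest c = length (filter (f≟ c) xs)

distinct⇒AllPairs : ∀ {A : Set} {R : A → A → Set} {xs} → Unique xs →
  (∀ {x y} → x ∈ xs → y ∈ xs → x ≢ y → R x y) → AllPairs R xs
distinct⇒AllPairs [] _ = []
distinct⇒AllPairs (x∉xs ∷ unique) R-distinct =
    All.tabulate (λ y∈xs → R-distinct (here refl) (there y∈xs) (All.lookup x∉xs y∈xs))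
  ∷ distinct⇒AllPairs unique (λ x∈ y∈ → R-distinct (there x∈) (there y∈))

fibre : ∀ {n M} → Fin n → List (Vec (Fin n) (suc M)) → List (Vec (Fin n) (suc M))
fibre c = filter (λ x → head x ≟ c)

module _ {q : ℕ} (pp : Prime (suc q)) where

  1<p : 1 ℕ.< suc q
  1<p = ℕ.nonTrivial⇒n>1 (suc q) {{prime⇒nonTrivial pp}}

  toℕ-subFp : ∀ x y → toℕ (subFp pp x y) ≡ (toℕ x ℕ.+ (suc q ∸ toℕ y)) % suc q
  toℕ-subFp x y = toℕ-fromℕ< _

  subFp-self : ∀ x → toℕ (subFp pp x x) ≡ 0
  subFp-self x = begin
    toℕ (subFp pp x x)                       ≡⟨ toℕ-subFp x x ⟩
    (toℕ x ℕ.+ (suc q ∸ toℕ x)) % suc q      ≡⟨ cong (_% suc q) (ℕ.m+[n∸m]≡n (ℕ.<⇒≤ (toℕ<n x))) ⟩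
    suc q % suc q                            ≡⟨ n%n≡0 (suc q) ⟩
    0                                        ∎
    where open ≡-Reasoning

  subFp-sucMod : ∀ x → toℕ (subFp pp (sucMod x) x) ≡ 1
  subFp-sucMod x with view x
  ... | ‵fromℕ = begin
    toℕ (subFp pp zero (fromℕ q))               ≡⟨ toℕ-subFp zero (fromℕ q) ⟩
    (suc q ∸ toℕ (fromℕ q)) % suc q             ≡⟨ cong (λ t → (suc q ∸ t) % suc q) (toℕ-fromℕ q) ⟩
    (suc q ∸ q) % suc q                         ≡⟨ cong (_% suc q) (ℕ.m+n∸n≡m 1 q) ⟩
    1 % suc q                                   ≡⟨ m<n⇒m%n≡m 1<p ⟩
    1                                           ∎
    where open ≡-Reasoning
  ... | ‵inject₁ j = begin
    toℕ (subFp pp (suc j) (inject₁ j))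
      ≡⟨ toℕ-subFp (suc j) (inject₁ j) ⟩
    suc (toℕ j ℕ.+ (suc q ∸ toℕ (inject₁ j))) % suc q
      ≡⟨ cong (λ t → suc (toℕ j ℕ.+ (suc q ∸ t)) % suc q) (toℕ-inject₁ j) ⟩
    suc (toℕ j ℕ.+ (suc q ∸ toℕ j)) % suc q
      ≡⟨ cong (λ t → suc t % suc q) (ℕ.m+[n∸m]≡n (ℕ.m<n⇒m≤1+n (toℕ<n j))) ⟩
    (1 ℕ.+ suc q) % suc q
      ≡⟨ [m+n]%n≡m%n 1 (suc q) ⟩
    1 % suc q
      ≡⟨ m<n⇒m%n≡m 1<p ⟩
    1 ∎
    where open ≡-Reasoning

  sucMod-≢ : ∀ x → sucMod x ≢ x
  sucMod-≢ x sx≡x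
    with trans (sym (subFp-sucMod x)) (trans (cong (λ z → toℕ (subFp pp z x)) sx≡x) (subFp-self x))
  ... | ()

  ≡⇒near : ∀ {a b} → b ≡ a → toℕ (subFp pp b a) ≤ 1
  ≡⇒near {a} refl = subst (_≤ 1) (sym (subFp-self a)) z≤n

  ≡sucMod⇒near : ∀ {a b} → b ≡ sucMod a → toℕ (subFp pp b a) ≤ 1
  ≡sucMod⇒near {a} refl = subst (_≤ 1) (sym (subFp-sucMod a)) ℕ.≤-refl

  cyclicDifference-diagonal≢0 : ∀ x → cyclicDifference x x ≢ 0ℤ
  cyclicDifference-diagonal≢0 x e with trans (sym (cong₂ _-_ (δ-refl x) (δ-≢ (sucMod-≢ x ∘ sym)))) e
  ... | ()

  cyclicDifference-vanishes : ∀ x y → ¬ toℕ (subFp pp y x) ≤ 1 → cyclicDifference x y ≡ 0ℤ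
  cyclicDifference-vanishes x y far = cong₂ _-_ (δ-≢ y≢x) (δ-≢ y≢sx)
    where
    y≢x : y ≢ x
    y≢x = far ∘ ≡⇒near
    y≢sx : y ≢ sucMod x
    y≢sx = far ∘ ≡sucMod⇒near

  cyclicPower-vanishes : ∀ {M} (x y : Fp^ (suc q) M) → ¬ InJ (subVec pp y x) →
    kernelPower cyclicDifference x y ≡ 0ℤ
  cyclicPower-vanishes [] [] y-x∉J = ⊥-elim (y-x∉J VecAll.[])
  cyclicPower-vanishes (a ∷ x) (b ∷ y) y-x∉J with toℕ (subFp pp b a) ℕ.≤? 1
  ... | yes near = trans (cong (cyclicDifference a b *_) (cyclicPower-vanishes x y (y-x∉J ∘ (near VecAll.∷_))))
                         (*-zeroʳ (cyclicDifference a b))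
  ... | no far = cong (_* kernelPower cyclicDifference x y) (cyclicDifference-vanishes a b far)

  J-chain-length≤ : ∀ {M} {xs : List (Fp^ (suc q) M)} →
    AllPairs (λ x y → ¬ InJ (subVec pp y x)) xs → length xs ≤ q ℕ.^ M
  J-chain-length≤ {M} chain =
    chain-length≤ (kernelPower-factorisation (zeroRowSum-factorisation cyclicDifference cyclicDifference-rowSum) M)
                  (kernelPower-diagonal≢0 cyclicDifference-diagonal≢0)
                  (AllPairs.map (cyclicPower-vanishes _ _) chain)

  module _ {M} {H : List (Fp^ (suc q) (suc M))} (unique : Unique H) (free : J-DiffFree pp H) where

    tail-difference∉J : ∀ {x y} → x ∈ H → y ∈ H → x ≢ y → toℕ (subFp pp (head y) (head x)) ≤ 1 →
      ¬ InJ (subVec pp (tail y) (tail x))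
    tail-difference∉J {_ ∷ _} {_ ∷ _} x∈H y∈H x≢y near = free y∈H x∈H (x≢y ∘ sym) ∘ (near VecAll.∷_)

    fibrePair-chain : ∀ c → AllPairs (λ x y → ¬ InJ (subVec pp (tail y) (tail x))) (fibre c H ++ fibre (sucMod c) H)
    fibrePair-chain c = AllPairs.++⁺ (inFibre c) (inFibre (sucMod c)) (All.tabulate (λ x∈ → All.tabulate (across x∈)))
      where
      inFibre : ∀ c → AllPairs (λ x y → ¬ InJ (subVec pp (tail y) (tail x))) (fibre c H)
      inFibre c = distinct⇒AllPairs (Unique.filter⁺ _ unique) λ x∈ y∈ x≢y →
        let x∈H , hx≡c = ∈-filter⁻ _ x∈
            y∈H , hy≡c = ∈-filter⁻ _ y∈
        in tail-difference∉J x∈H y∈H x≢y (≡⇒near (trans hy≡c (sym hx≡c)))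
      across : ∀ {x y} → x ∈ fibre c H → y ∈ fibre (sucMod c) H → ¬ InJ (subVec pp (tail y) (tail x))
      across x∈ y∈ =
        let x∈H , hx≡c = ∈-filter⁻ _ x∈
            y∈H , hy≡sc = ∈-filter⁻ _ y∈
        in tail-difference∉J x∈H y∈H
             (λ x≡y → sucMod-≢ c (trans (sym hy≡sc) (trans (cong head (sym x≡y)) hx≡c)))
             (≡sucMod⇒near (trans hy≡sc (cong sucMod (sym hx≡c))))

    fibrePair-length≤ : ∀ c → length (fibre c H) ℕ.+ length (fibre (sucMod c) H) ≤ q ℕ.^ M
    fibrePair-length≤ c =
      subst (_≤ q ℕ.^ M) (trans (length-map tail (fibre c H ++ fibre (sucMod c) H)) (length-++ (fibre c H)))
            (J-chain-length≤ (AllPairs.map⁺ (fibrePair-chain c)))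

    double-counting : 2 ℕ.* length H ≤ suc q ℕ.* q ℕ.^ M
    double-counting = begin
      2 ℕ.* length H
        ≡⟨ cong (length H ℕ.+_) (ℕ.+-identityʳ (length H)) ⟩
      length H ℕ.+ length H
        ≡⟨ cong₂ ℕ._+_ (ℕ∑-length-filter head H)
                       (trans (ℕ∑-∘sucMod fibreSize) (ℕ∑-length-filter head H)) ⟨
      ℕ∑.sum fibreSize ℕ.+ ℕ∑.sum (fibreSize ∘ sucMod)
        ≡⟨ ℕ∑.∑-distrib-+ fibreSize (fibreSize ∘ sucMod) ⟨
      ℕ∑.sum (λ c → fibreSize c ℕ.+ fibreSize (sucMod c))
        ≤⟨ ℕ∑-≤-* _ fibrePair-length≤ ⟩
      suc q ℕ.* q ℕ.^ M ∎
      where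
      open ℕ.≤-Reasoning
      fibreSize : Fin (suc q) → ℕ
      fibreSize c = length (fibre c H)

theorem3 : (p N : ℕ) (pp : Prime p) → 1 ℕ.≤ N →
    (H : List (Fp^ p N)) → Unique H → J-DiffFree pp H →
    (ℤ.+ length H / 1) ℚ.≤ bound pp N
theorem3 0 _ pp = ⊥-elim (¬prime[0] pp)
theorem3 1 _ pp = ⊥-elim (¬prime[1] pp)
theorem3 (suc (suc q′)) zero _ ()
theorem3 (suc (suc q′)) (suc M) pp _ H unique free =
  halving-bound q′ M (length H) (double-counting pp unique free)
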